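{- For any integers $k \geq 2$ and $\beta \geq 0$, $$C_{k,(0,\beta)}(t,z) = \sum_{i \geq 0} z^i t^i C_k(t)^{\beta + i(k-1)}.$$
   Context: For an integer $k\ge 2$ and integers $\alpha,\beta, n\ge 0$, let $\mathcal{D}^k_{n,(\alpha,\beta)}$ be the set of integer lattice paths from $(0,\alpha)$ to $(kn+\beta-\alpha,\beta)$ using steps $U=(1,1)$ and $D=(1,1-k)$ that stay weakly above the line $y=0$ (such paths have exactly $n$ steps $D$; the empty path is included when $n=0$, $\alpha=\beta$). A return to ground of a path is a $D$ step whose right endpoint lies on $y=0$ (the initial point is never a return). $C^k_{n,(\alpha,\beta),\rho}$ is the number of paths in $\mathcal{D}^k_{n,(\alpha,\beta)}$ with exactly $\rho$ returns to ground, and $C_{k,(\alpha,\beta)}(t,z)=\sum_{n,\rho\ge0}C^k_{n,(\alpha,\beta),\rho}t^nz^\rho$. $C_k(t)=\sum_{n\ge0} \frac{1}{kn+1}\binom{kn+1}{n} t^n$ is the $k$-Catalan generating function. -}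

module Defs where

open import Data.Nat using (ℕ; zero; suc; _+_; _*_; _∸_; _≤ᵇ_; _≡ᵇ_; _/_)
open import Data.Nat.Combinatorics using (_C_)
open import Data.Bool using (Bool; true; false; if_then_else_; _∧_)
open import Data.List using (List; []; _∷_; map; _++_)
open import Data.Nat.ListAction using (sum)

-- Lattice paths with steps U = (1,1) and D = (1,1-k)

data Step : Set where
  U D : Step

words : ℕ → List (List Step)
words zero    = [] ∷ []
words (suc L) = map (U ∷_) (words L) ++ map (D ∷_) (words L)

-- walk k h p downs rets : starting at height h, follow p; having already
-- seen `downs` D steps and `rets` returns to ground, decide whether the
-- path stays weakly above y = 0 and ends at height β with exactly n D steps
-- and exactly ρ returns (a return = a D step whose right endpoint is on y=0).
accepts : (k h β n ρ : ℕ) → (downs rets : ℕ) → List Step → Bool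
accepts k h β n ρ downs rets []      = (h ≡ᵇ β) ∧ ((downs ≡ᵇ n) ∧ (rets ≡ᵇ ρ))
accepts k h β n ρ downs rets (U ∷ p) = accepts k (suc h) β n ρ downs rets p
accepts k h β n ρ downs rets (D ∷ p) =
  if (k ∸ 1) ≤ᵇ h
  then (if (h ∸ (k ∸ 1)) ≡ᵇ 0
        then accepts k 0 β n ρ (suc downs) (suc rets) p
        else accepts k (h ∸ (k ∸ 1)) β n ρ (suc downs) rets p)
  else false

-- C^k_{n,(α,β),ρ}: number of paths from (0,α) to (kn+β-α, β) with steps U, D,
-- weakly above y = 0, with exactly n steps D and exactly ρ returns to ground.
-- Such paths have exactly kn+β-α steps.
pathCount : (k n α β ρ : ℕ) → ℕ
pathCount k n α β ρ =
  sum (map (λ p → if accepts k α β n ρ 0 0 p then 1 else 0) (words (k * n + β ∸ α)))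

-- Bivariate generating function C_{k,(α,β)}(t,z), as its coefficient array:
-- CGF k α β n ρ = [t^n z^ρ] C_{k,(α,β)}(t,z).
CGF : (k α β : ℕ) → ℕ → ℕ → ℕ
CGF k α β n ρ = pathCount k n α β ρ

Series : Set
Series = ℕ → ℕ

sumTo : ℕ → (ℕ → ℕ) → ℕ
sumTo zero    f = f 0
sumTo (suc n) f = sumTo n f + f (suc n)

_⊛_ : Series → Series → Series
(f ⊛ g) n = sumTo n (λ i → f i * g (n ∸ i))

one : Series
one zero    = 1
one (suc _) = 0

_^ˢ_ : Series → ℕ → Series
f ^ˢ zero  = one
f ^ˢ suc m = f ⊛ (f ^ˢ m)

tPow : ℕ → Series
tPow i n = if n ≡ᵇ i then 1 else 0

Ck : ℕ → Series
Ck k n = ((suc (k * n)) C n) / suc (k * n)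

-- Right-hand side Σ_{i≥0} z^i t^i C_k(t)^{β+i(k-1)} as a coefficient array:
-- the coefficient of z^ρ is the series t^ρ C_k(t)^{β+ρ(k-1)}.
RHS : (k β : ℕ) → ℕ → ℕ → ℕ
RHS k β n ρ = (tPow ρ ⊛ (Ck k ^ˢ (β + ρ * (k ∸ 1)))) n

module Submission where

open import Defs
open import Data.Nat using (ℕ; zero; suc; _+_; _*_; _∸_; _≤_; _≡ᵇ_; _≤ᵇ_; _/_; s≤s; z<s; NonZero; >-nonZero)
open import Data.Nat.Properties
open import Data.Nat.Combinatorics using (_C_; nC1≡n; nCk+nC[k+1]≡[n+1]C[k+1])
open import Data.Nat.DivMod using (m*n/n≡m)
open import Data.Nat.Tactic.RingSolver using (solve-∀)
open import Data.Nat.ListAction using (sum)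
open import Data.Nat.ListAction.Properties using (sum-++)
open import Algebra.Properties.CommutativeSemigroup +-commutativeSemigroup using (interchange; xy∙z≈xz∙y)
open import Data.Bool using (Bool; false; if_then_else_; _∧_)
open import Data.Bool.Properties using (∧-zeroʳ)
open import Data.List using (List; []; _∷_; _++_; map; [_])
open import Data.List.Properties using (map-++; map-∘; map-cong)
open import Data.Maybe using (Maybe; just; nothing; maybe′; _>>=_)
open import Data.Product using (_×_; _,_)
open import Function using (_∘_)
open import Relation.Binary.PropositionalEquality
  using (_≡_; refl; sym; trans; cong; cong₂; subst; _≗_; module ≡-Reasoning)

-- Write K = k - 1 and m = β + ρK. A path from the ground ending at height β + 1 ends with U from
-- height β or with D from height β + k, and one ending on the ground ends with a D step from
-- height K, which is a return. These are the recurrences C^(m+1) = C^m + t C^(m+k) (from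
-- C = 1 + t C^k) of the Raney numbers [t^j] C_k(t)^m, each return lowering the remaining number
-- of D steps by one; so the count is [t^(n-ρ)] C_k(t)^(β+ρK). The Raney numbers are matched with
-- C_k itself through the ballot formula (m + jk) [t^j] C_k^m = m binom(m + jk, j).

binomial-absorption : ∀ n k → suc k * (suc n C suc k) ≡ suc n * (n C k)
binomial-absorption n zero =
  trans (*-identityˡ (suc n C 1)) (trans (nC1≡n (suc n)) (sym (*-identityʳ (suc n))))
binomial-absorption zero (suc k) = *-zeroʳ (suc (suc k))
binomial-absorption (suc n) (suc k) = begin
  suc (suc k) * (suc (suc n) C suc (suc k))
    ≡⟨ cong (suc (suc k) *_) (sym (nCk+nC[k+1]≡[n+1]C[k+1] (suc n) (suc k))) ⟩
  suc (suc k) * (a + b)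
    ≡⟨ *-distribˡ-+ (suc (suc k)) a b ⟩
  (a + suc k * a) + suc (suc k) * b
    ≡⟨ cong₂ (λ x y → (a + x) + y) (binomial-absorption n k) (binomial-absorption n (suc k)) ⟩
  (a + suc n * (n C k)) + suc n * (n C suc k)
    ≡⟨ +-assoc a _ _ ⟩
  a + (suc n * (n C k) + suc n * (n C suc k))
    ≡⟨ cong (a +_) (sym (*-distribˡ-+ (suc n) (n C k) (n C suc k))) ⟩
  a + suc n * (n C k + n C suc k)
    ≡⟨ cong (λ x → a + suc n * x) (nCk+nC[k+1]≡[n+1]C[k+1] n k) ⟩
  suc (suc n) * a
    ∎
  where
  open ≡-Reasoning
  a = suc n C suc k
  b = suc n C suc (suc k)

-- raney k m is C_k(t)^m (Ck^≡raney), computed by C^(m+1) = C^m + t C^(m+k).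
raney : ℕ → ℕ → Series
raney k m       zero    = 1
raney k zero    (suc j) = 0
raney k (suc m) (suc j) = raney k m (suc j) + raney k (m + k) j

-- The inductive step of the ballot formula: X, Y are the two summands of the recursion for raney,
-- c, d the two summands of Pascal's rule; the hypotheses only apply after multiplying by M.
ballot-algebra : ∀ K j m X Y c d →
  (m + suc j * suc K) * X ≡ m * d →
  (m + suc j * suc K) * Y ≡ (m + suc K) * c →
  suc j * (c + d) ≡ suc (m + suc j * suc K) * c →
  suc (m + suc j * suc K) * (X + Y) ≡ suc m * (c + d)
ballot-algebra K j m X Y c d hX hY hcd = *-cancelˡ-≡ _ _ M {{M≢0}} (begin
  M * (suc M * (X + Y))           ≡⟨ factor K j m X Y ⟩
  suc M * (M * X + M * Y)         ≡⟨ cong₂ (λ x y → suc M * (x + y)) hX hY ⟩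
  suc M * (m * d + (m + k) * c)   ≡⟨ left K j m c d ⟩
  S + k * (suc M * c)             ≡⟨ cong (λ x → S + k * x) (sym hcd) ⟩
  S + k * (suc j * (c + d))       ≡⟨ right K j m c d ⟩
  M * (suc m * (c + d))           ∎)
  where
  open ≡-Reasoning
  k = suc K
  M = m + suc j * k
  S = m * suc m * (c + d) + m * k * (suc j * (c + d))
  M≢0 : NonZero M
  M≢0 = >-nonZero (<-≤-trans z<s (m≤n+m (suc j * k) m))
  factor : ∀ K j m X Y →
    (m + suc j * suc K) * (suc (m + suc j * suc K) * (X + Y))
      ≡ suc (m + suc j * suc K) * ((m + suc j * suc K) * X + (m + suc j * suc K) * Y)
  factor = solve-∀
  left : ∀ K j m c d →
    suc (m + suc j * suc K) * (m * d + (m + suc K) * c)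
      ≡ (m * suc m * (c + d) + m * suc K * (suc j * (c + d)))
        + suc K * (suc (m + suc j * suc K) * c)
  left = solve-∀
  right : ∀ K j m c d →
    (m * suc m * (c + d) + m * suc K * (suc j * (c + d))) + suc K * (suc j * (c + d))
      ≡ (m + suc j * suc K) * (suc m * (c + d))
  right = solve-∀

raney-ballot : ∀ K m j → (m + j * suc K) * raney (suc K) m j ≡ m * ((m + j * suc K) C j)
raney-ballot K m       zero    = cong (_* 1) (+-identityʳ m)
raney-ballot K zero    (suc j) = *-zeroʳ (suc j * suc K)
raney-ballot K (suc m) (suc j) =
  trans (ballot-algebra K j m _ _ _ _ (raney-ballot K m (suc j)) shifted pascal-absorption)
        (cong (suc m *_) (nCk+nC[k+1]≡[n+1]C[k+1] M j))
  where
  k = suc K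
  M = m + suc j * k
  shifted : M * raney k (m + k) j ≡ (m + k) * (M C j)
  shifted = subst (λ n → n * raney k (m + k) j ≡ (m + k) * (n C j))
                  (+-assoc m k (j * k)) (raney-ballot K (m + k) j)
  pascal-absorption : suc j * (M C j + M C suc j) ≡ suc M * (M C j)
  pascal-absorption = trans (cong (suc j *_) (nCk+nC[k+1]≡[n+1]C[k+1] M j))
                            (binomial-absorption M j)

Ck≡raney : ∀ K → Ck (suc K) ≗ raney (suc K) 1
Ck≡raney K j rewrite *-comm (suc K) j = begin
  (suc N C j) / suc N                ≡⟨ cong (_/ suc N) (sym (trans (raney-ballot K 1 j) (*-identityˡ (suc N C j)))) ⟩
  suc N * raney (suc K) 1 j / suc N  ≡⟨ cong (_/ suc N) (*-comm (suc N) (raney (suc K) 1 j)) ⟩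
  raney (suc K) 1 j * suc N / suc N  ≡⟨ m*n/n≡m (raney (suc K) 1 j) (suc N) ⟩
  raney (suc K) 1 j                  ∎
  where
  open ≡-Reasoning
  N = j * suc K

sumTo-cong : ∀ n {f g : ℕ → ℕ} → f ≗ g → sumTo n f ≡ sumTo n g
sumTo-cong zero    f≗g = f≗g 0
sumTo-cong (suc n) f≗g = cong₂ _+_ (sumTo-cong n f≗g) (f≗g (suc n))

sumTo-+ : ∀ n (f g : ℕ → ℕ) → sumTo n (λ i → f i + g i) ≡ sumTo n f + sumTo n g
sumTo-+ zero    f g = refl
sumTo-+ (suc n) f g = trans (cong (_+ (f (suc n) + g (suc n))) (sumTo-+ n f g))
                            (interchange (sumTo n f) (sumTo n g) (f (suc n)) (g (suc n)))

sumTo-sucˡ : ∀ n (f : ℕ → ℕ) → sumTo (suc n) f ≡ f 0 + sumTo n (f ∘ suc)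
sumTo-sucˡ zero    f = refl
sumTo-sucˡ (suc n) f = trans (cong (_+ f (suc (suc n))) (sumTo-sucˡ n f)) (+-assoc (f 0) _ _)

sumTo-one : ∀ n (f : ℕ → ℕ) → sumTo n (λ i → one i * f i) ≡ f 0
sumTo-one zero    f = +-identityʳ (f 0)
sumTo-one (suc n) f = trans (+-identityʳ _) (sumTo-one n f)

⊛-cong : ∀ {f f′ g g′ : Series} → f ≗ f′ → g ≗ g′ → f ⊛ g ≗ f′ ⊛ g′
⊛-cong f≗f′ g≗g′ n = sumTo-cong n (λ i → cong₂ _*_ (f≗f′ i) (g≗g′ (n ∸ i)))

⊛-congˡ : ∀ g {f f′ : Series} → f ≗ f′ → f ⊛ g ≗ f′ ⊛ g
⊛-congˡ g f≗f′ = ⊛-cong {g = g} f≗f′ (λ _ → refl)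

⊛-identityˡ : ∀ g → one ⊛ g ≗ g
⊛-identityˡ g n = sumTo-one n (λ i → g (n ∸ i))

⊛-distribʳ-+ : ∀ f g h → (λ i → f i + g i) ⊛ h ≗ (λ n → (f ⊛ h) n + (g ⊛ h) n)
⊛-distribʳ-+ f g h n =
  trans (sumTo-cong n (λ i → *-distribʳ-+ (h (n ∸ i)) (f i) (g i)))
        (sumTo-+ n (λ i → f i * h (n ∸ i)) (λ i → g i * h (n ∸ i)))

⊛-sucˡ : ∀ f g n → (f ⊛ g) (suc n) ≡ f 0 * g (suc n) + ((f ∘ suc) ⊛ g) n
⊛-sucˡ f g n = sumTo-sucˡ n (λ i → f i * g (suc n ∸ i))

shift : ℕ → Series → Series
shift zero    g n       = g n
shift (suc ρ) g zero    = 0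
shift (suc ρ) g (suc n) = shift ρ g n

tPow-⊛ : ∀ ρ g → tPow ρ ⊛ g ≗ shift ρ g
tPow-⊛ zero    g n       = trans (⊛-congˡ g tPow0≗one n) (⊛-identityˡ g n)
  where
  tPow0≗one : tPow 0 ≗ one
  tPow0≗one zero    = refl
  tPow0≗one (suc i) = refl
tPow-⊛ (suc ρ) g zero    = refl
tPow-⊛ (suc ρ) g (suc n) = trans (⊛-sucˡ (tPow (suc ρ)) g n) (tPow-⊛ ρ g n)

raney-zero : ∀ k → raney k 0 ≗ one
raney-zero k zero    = refl
raney-zero k (suc j) = refl

raney-suc : ∀ k m → raney k (suc m) ≗ (λ j → raney k m j + shift 1 (raney k (m + k)) j)
raney-suc k m zero    = refl
raney-suc k m (suc j) = refl

raney-⊛ : ∀ k a b → raney k a ⊛ raney k b ≗ raney k (a + b)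
raney-⊛ k zero    b j       = trans (⊛-congˡ (raney k b) (raney-zero k) j) (⊛-identityˡ (raney k b) j)
raney-⊛ k (suc a) b zero    = refl
raney-⊛ k (suc a) b (suc j) = begin
  (raney k (suc a) ⊛ raney k b) (suc j)
    ≡⟨ ⊛-congˡ (raney k b) (raney-suc k a) (suc j) ⟩
  ((λ i → raney k a i + shift 1 (raney k (a + k)) i) ⊛ raney k b) (suc j)
    ≡⟨ ⊛-distribʳ-+ (raney k a) (shift 1 (raney k (a + k))) (raney k b) (suc j) ⟩
  (raney k a ⊛ raney k b) (suc j) + (shift 1 (raney k (a + k)) ⊛ raney k b) (suc j)
    ≡⟨ cong₂ _+_ (raney-⊛ k a b (suc j)) (⊛-sucˡ (shift 1 (raney k (a + k))) (raney k b) j) ⟩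
  raney k (a + b) (suc j) + (raney k (a + k) ⊛ raney k b) j
    ≡⟨ cong (raney k (a + b) (suc j) +_) (raney-⊛ k (a + k) b j) ⟩
  raney k (a + b) (suc j) + raney k (a + k + b) j
    ≡⟨ cong (λ m → raney k (a + b) (suc j) + raney k m j) (xy∙z≈xz∙y a k b) ⟩
  raney k (suc a + b) (suc j)
    ∎
  where open ≡-Reasoning

shift-raney-suc : ∀ k m ρ n →
  shift ρ (raney k (suc m)) n ≡ shift ρ (raney k m) n + shift (suc ρ) (raney k (m + k)) n
shift-raney-suc k m zero    n       = raney-suc k m n
shift-raney-suc k m (suc ρ) zero    = refl
shift-raney-suc k m (suc ρ) (suc n) = shift-raney-suc k m ρ n

Ck^≡raney : ∀ K m → Ck (suc K) ^ˢ m ≗ raney (suc K) m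
Ck^≡raney K zero    j = sym (raney-zero (suc K) j)
Ck^≡raney K (suc m) j =
  trans (⊛-cong (Ck≡raney K) (Ck^≡raney K m) j) (raney-⊛ (suc K) 1 m j)

sumWords : ℕ → (List Step → ℕ) → ℕ
sumWords L f = sum (map f (words L))

sumWords-cong : ∀ L {f g : List Step → ℕ} → f ≗ g → sumWords L f ≡ sumWords L g
sumWords-cong L f≗g = cong sum (map-cong f≗g (words L))

sumWords-cons : ∀ L f → sumWords (suc L) f ≡ sumWords L (f ∘ (U ∷_)) + sumWords L (f ∘ (D ∷_))
sumWords-cons L f = begin
  sum (map f (map (U ∷_) ws ++ map (D ∷_) ws))
    ≡⟨ cong sum (map-++ f (map (U ∷_) ws) (map (D ∷_) ws)) ⟩
  sum (map f (map (U ∷_) ws) ++ map f (map (D ∷_) ws))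
    ≡⟨ sum-++ (map f (map (U ∷_) ws)) (map f (map (D ∷_) ws)) ⟩
  sum (map f (map (U ∷_) ws)) + sum (map f (map (D ∷_) ws))
    ≡⟨ cong₂ _+_ (cong sum (sym (map-∘ ws))) (cong sum (sym (map-∘ ws))) ⟩
  sumWords L (f ∘ (U ∷_)) + sumWords L (f ∘ (D ∷_))
    ∎
  where
  open ≡-Reasoning
  ws = words L

sumWords-snoc : ∀ L f →
  sumWords (suc L) f ≡ sumWords L (λ p → f (p ++ [ U ])) + sumWords L (λ p → f (p ++ [ D ]))
sumWords-snoc zero    f = sumWords-cons zero f
sumWords-snoc (suc L) f = begin
  sumWords (suc (suc L)) f
    ≡⟨ sumWords-cons (suc L) f ⟩
  sumWords (suc L) (f ∘ (U ∷_)) + sumWords (suc L) (f ∘ (D ∷_))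
    ≡⟨ cong₂ _+_ (sumWords-snoc L (f ∘ (U ∷_))) (sumWords-snoc L (f ∘ (D ∷_))) ⟩
  (UU + UD) + (DU + DD)
    ≡⟨ interchange UU UD DU DD ⟩
  (UU + DU) + (UD + DD)
    ≡⟨ cong₂ _+_ (sym (sumWords-cons L (λ p → f (p ++ [ U ])))) (sym (sumWords-cons L (λ p → f (p ++ [ D ])))) ⟩
  sumWords (suc L) (λ p → f (p ++ [ U ])) + sumWords (suc L) (λ p → f (p ++ [ D ]))
    ∎
  where
  open ≡-Reasoning
  UU = sumWords L (λ p → f (U ∷ p ++ [ U ]))
  UD = sumWords L (λ p → f (U ∷ p ++ [ D ]))
  DU = sumWords L (λ p → f (D ∷ p ++ [ U ]))
  DD = sumWords L (λ p → f (D ∷ p ++ [ D ]))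

sumWords-zero : ∀ L {f} → (∀ p → f p ≡ 0) → sumWords L f ≡ 0
sumWords-zero zero    f≡0 = cong (_+ 0) (f≡0 [])
sumWords-zero (suc L) f≡0 =
  trans (sumWords-cons L _) (cong₂ _+_ (sumWords-zero L (f≡0 ∘ (U ∷_))) (sumWords-zero L (f≡0 ∘ (D ∷_))))

-- (height, number of D steps, number of returns to ground)
State : Set
State = ℕ × ℕ × ℕ

up : State → Maybe State
up (h , d , r) = just (suc h , d , r)

-- A D step lowers the height by K = k - 1; it is a return when it lands on 0.
down : ℕ → State → Maybe State
down zero    (zero  , d , r) = just (zero , suc d , suc r)
down zero    (suc h , d , r) = just (suc h , suc d , r)
down (suc K) (zero  , d , r) = nothing
down (suc K) (suc h , d , r) = down K (h , d , r)

step : ℕ → Step → State → Maybe State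
step K U = up
step K D = down K

walk : ℕ → State → List Step → Maybe State
walk K s []      = just s
walk K s (x ∷ p) = step K x s >>= λ s′ → walk K s′ p

walk-snoc : ∀ K s p x → walk K s (p ++ [ x ]) ≡ (walk K s p >>= step K x)
walk-snoc K s []      x with step K x s
... | nothing = refl
... | just s′ = refl
walk-snoc K s (y ∷ p) x with step K y s
... | nothing = refl
... | just s′ = walk-snoc K s′ p x

endsAt : Maybe State → State → Bool
endsAt nothing            _           = false
endsAt (just (h , d , r)) (β , n , ρ) = (h ≡ᵇ β) ∧ ((d ≡ᵇ n) ∧ (r ≡ᵇ ρ))

≤ᵇ-suc : ∀ m n → (suc m ≤ᵇ suc n) ≡ (m ≤ᵇ n)
≤ᵇ-suc zero    n = refl
≤ᵇ-suc (suc m) n = refl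

down-if : ∀ {A : Set} K h d r (g : State → A) (z : A) →
  (if K ≤ᵇ h then (if h ∸ K ≡ᵇ 0 then g (0 , suc d , suc r) else g (h ∸ K , suc d , r)) else z)
    ≡ maybe′ g z (down K (h , d , r))
down-if zero    zero    d r g z = refl
down-if zero    (suc h) d r g z = refl
down-if (suc K) zero    d r g z = refl
down-if (suc K) (suc h) d r g z rewrite ≤ᵇ-suc K h = down-if K h d r g z

accepts≡endsAt-walk : ∀ K β n ρ h d r p →
  accepts (suc K) h β n ρ d r p ≡ endsAt (walk K (h , d , r) p) (β , n , ρ)
accepts≡endsAt-walk K β n ρ h d r []      = refl
accepts≡endsAt-walk K β n ρ h d r (U ∷ p) = accepts≡endsAt-walk K β n ρ (suc h) d r p
accepts≡endsAt-walk K β n ρ h d r (D ∷ p) =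
  trans (down-if K h d r acceptsRest false) (continue (down K (h , d , r)))
  where
  acceptsRest : State → Bool
  acceptsRest (h′ , d′ , r′) = accepts (suc K) h′ β n ρ d′ r′ p
  continue : ∀ t → maybe′ acceptsRest false t ≡ endsAt (t >>= λ s → walk K s p) (β , n , ρ)
  continue nothing             = refl
  continue (just (h′ , d′ , r′)) = accepts≡endsAt-walk K β n ρ h′ d′ r′ p

endsAt-bind : ∀ {f : State → Maybe State} {a b} →
  (∀ s → endsAt (f s) a ≡ endsAt (just s) b) → ∀ t → endsAt (t >>= f) a ≡ endsAt t b
endsAt-bind eq nothing  = refl
endsAt-bind eq (just s) = eq s

endsAt-bind-false : ∀ {f : State → Maybe State} {a} →
  (∀ s → endsAt (f s) a ≡ false) → ∀ t → endsAt (t >>= f) a ≡ false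
endsAt-bind-false eq nothing  = refl
endsAt-bind-false eq (just s) = eq s

up-endsAt-suc : ∀ β n ρ s → endsAt (up s) (suc β , n , ρ) ≡ endsAt (just s) (β , n , ρ)
up-endsAt-suc β n ρ (h , d , r) = refl

up-endsAt-zero : ∀ n ρ s → endsAt (up s) (0 , n , ρ) ≡ false
up-endsAt-zero n ρ (h , d , r) = refl

down-endsAt-zero-downs : ∀ K β ρ s → endsAt (down K s) (β , 0 , ρ) ≡ false
down-endsAt-zero-downs zero    β ρ (zero  , d , r) = ∧-zeroʳ (0 ≡ᵇ β)
down-endsAt-zero-downs zero    β ρ (suc h , d , r) = ∧-zeroʳ (suc h ≡ᵇ β)
down-endsAt-zero-downs (suc K) β ρ (zero  , d , r) = refl
down-endsAt-zero-downs (suc K) β ρ (suc h , d , r) = down-endsAt-zero-downs K β ρ (h , d , r)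

down-endsAt-suc : ∀ K β n ρ s → endsAt (down K s) (suc β , suc n , ρ) ≡ endsAt (just s) (K + suc β , n , ρ)
down-endsAt-suc zero    β n ρ (zero  , d , r) = refl
down-endsAt-suc zero    β n ρ (suc h , d , r) = refl
down-endsAt-suc (suc K) β n ρ (zero  , d , r) = refl
down-endsAt-suc (suc K) β n ρ (suc h , d , r) = down-endsAt-suc K β n ρ (h , d , r)

down-endsAt-return : ∀ K n ρ s → endsAt (down K s) (0 , suc n , suc ρ) ≡ endsAt (just s) (K , n , ρ)
down-endsAt-return zero    n ρ (zero  , d , r) = refl
down-endsAt-return zero    n ρ (suc h , d , r) = refl
down-endsAt-return (suc K) n ρ (zero  , d , r) = refl
down-endsAt-return (suc K) n ρ (suc h , d , r) = down-endsAt-return K n ρ (h , d , r)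

down-endsAt-zero-returns : ∀ K n s → endsAt (down K s) (0 , n , 0) ≡ false
down-endsAt-zero-returns zero    n (zero  , d , r) = ∧-zeroʳ (suc d ≡ᵇ n)
down-endsAt-zero-returns zero    n (suc h , d , r) = refl
down-endsAt-zero-returns (suc K) n (zero  , d , r) = refl
down-endsAt-zero-returns (suc K) n (suc h , d , r) = down-endsAt-zero-returns K n (h , d , r)

𝟙 : Bool → ℕ
𝟙 b = if b then 1 else 0

pathsTo : ℕ → ℕ → State → ℕ
pathsTo K L s = sumWords L (λ p → 𝟙 (endsAt (walk K (0 , 0 , 0) p) s))

pathsEndingWith : ℕ → ℕ → Step → State → ℕ
pathsEndingWith K L x s = sumWords L (λ p → 𝟙 (endsAt (walk K (0 , 0 , 0) p >>= step K x) s))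

pathsTo-suc : ∀ K L s → pathsTo K (suc L) s ≡ pathsEndingWith K L U s + pathsEndingWith K L D s
pathsTo-suc K L s = trans (sumWords-snoc L _) (cong₂ _+_ (last U) (last D))
  where
  last : ∀ x → sumWords L (λ p → 𝟙 (endsAt (walk K (0 , 0 , 0) (p ++ [ x ])) s)) ≡ pathsEndingWith K L x s
  last x = sumWords-cong L (λ p → cong (λ t → 𝟙 (endsAt t s)) (walk-snoc K (0 , 0 , 0) p x))

pathsEndingWith-from : ∀ K L x {a b} → (∀ s → endsAt (step K x s) a ≡ endsAt (just s) b) →
  pathsEndingWith K L x a ≡ pathsTo K L b
pathsEndingWith-from K L x eq =
  sumWords-cong L (λ p → cong 𝟙 (endsAt-bind eq (walk K (0 , 0 , 0) p)))

pathsEndingWith-none : ∀ K L x {a} → (∀ s → endsAt (step K x s) a ≡ false) →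
  pathsEndingWith K L x a ≡ 0
pathsEndingWith-none K L x eq =
  sumWords-zero L (λ p → cong 𝟙 (endsAt-bind-false eq (walk K (0 , 0 , 0) p)))

pathsTo-ground-no-return : ∀ K L n → pathsTo K (suc L) (0 , n , 0) ≡ 0
pathsTo-ground-no-return K L n =
  trans (pathsTo-suc K L _) (cong₂ _+_ (pathsEndingWith-none K L U (up-endsAt-zero n 0))
                                       (pathsEndingWith-none K L D (down-endsAt-zero-returns K n)))

pathsTo-ground-return : ∀ K L n ρ → pathsTo K (suc L) (0 , suc n , suc ρ) ≡ pathsTo K L (K , n , ρ)
pathsTo-ground-return K L n ρ =
  trans (pathsTo-suc K L _) (cong₂ _+_ (pathsEndingWith-none K L U (up-endsAt-zero (suc n) (suc ρ)))
                                       (pathsEndingWith-from K L D (down-endsAt-return K n ρ)))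

pathsTo-above-no-downs : ∀ K L β ρ → pathsTo K (suc L) (suc β , 0 , ρ) ≡ pathsTo K L (β , 0 , ρ)
pathsTo-above-no-downs K L β ρ =
  trans (pathsTo-suc K L _) (trans (cong₂ _+_ (pathsEndingWith-from K L U (up-endsAt-suc β 0 ρ))
                                              (pathsEndingWith-none K L D (down-endsAt-zero-downs K (suc β) ρ)))
                                   (+-identityʳ _))

pathsTo-above : ∀ K L β n ρ →
  pathsTo K (suc L) (suc β , suc n , ρ) ≡ pathsTo K L (β , suc n , ρ) + pathsTo K L (K + suc β , n , ρ)
pathsTo-above K L β n ρ =
  trans (pathsTo-suc K L _) (cong₂ _+_ (pathsEndingWith-from K L U (up-endsAt-suc β (suc n) ρ))
                                       (pathsEndingWith-from K L D (down-endsAt-suc K β n ρ)))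

length-before-down : ∀ K L n b → suc L ≡ suc n * suc K + b → L ≡ n * suc K + (K + b)
length-before-down K L n b eq = suc-injective (trans eq (rearrange K n b))
  where
  rearrange : ∀ K n b → suc n * suc K + b ≡ suc (n * suc K + (K + b))
  rearrange = solve-∀

pathsTo-raney : ∀ K L β n ρ → L ≡ n * suc K + β →
  pathsTo K L (β , n , ρ) ≡ shift ρ (raney (suc K) (β + ρ * K)) n
pathsTo-raney K zero    zero    zero    zero    _  = refl
pathsTo-raney K zero    zero    zero    (suc ρ) _  = refl
pathsTo-raney K zero    (suc β) zero    ρ       ()
pathsTo-raney K zero    β       (suc n) ρ       ()
pathsTo-raney K (suc L) zero    zero    ρ       ()
pathsTo-raney K (suc L) zero    (suc n) zero    _  = pathsTo-ground-no-return K L (suc n)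
pathsTo-raney K (suc L) zero    (suc n) (suc ρ) eq =
  trans (pathsTo-ground-return K L n ρ)
        (pathsTo-raney K L K n ρ (trans (length-before-down K L n 0 eq) (cong (n * suc K +_) (+-identityʳ K))))
pathsTo-raney K (suc L) (suc β) zero    ρ       eq =
  trans (pathsTo-above-no-downs K L β ρ)
        (trans (pathsTo-raney K L β 0 ρ (suc-injective eq))
               (sym (trans (shift-raney-suc (suc K) (β + ρ * K) ρ 0) (+-identityʳ _))))
pathsTo-raney K (suc L) (suc β) (suc n) ρ       eq = begin
  pathsTo K (suc L) (suc β , suc n , ρ)
    ≡⟨ pathsTo-above K L β n ρ ⟩
  pathsTo K L (β , suc n , ρ) + pathsTo K L (K + suc β , n , ρ)
    ≡⟨ cong₂ _+_ (pathsTo-raney K L β (suc n) ρ (suc-injective (trans eq (+-suc _ β))))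
                 (pathsTo-raney K L (K + suc β) n ρ (length-before-down K L n (suc β) eq)) ⟩
  shift ρ (raney k m) (suc n) + shift ρ (raney k (K + suc β + ρ * K)) n
    ≡⟨ cong (λ e → shift ρ (raney k m) (suc n) + shift ρ (raney k e) n) (exponent K β ρ) ⟩
  shift ρ (raney k m) (suc n) + shift (suc ρ) (raney k (m + k)) (suc n)
    ≡⟨ sym (shift-raney-suc k m ρ (suc n)) ⟩
  shift ρ (raney k (suc m)) (suc n)
    ∎
  where
  open ≡-Reasoning
  k = suc K
  m = β + ρ * K
  exponent : ∀ K β ρ → K + suc β + ρ * K ≡ β + ρ * K + suc K
  exponent = solve-∀

CGF≡RHS : ∀ K β n ρ → CGF (suc K) 0 β n ρ ≡ RHS (suc K) β n ρ
CGF≡RHS K β n ρ = begin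
  CGF (suc K) 0 β n ρ
    ≡⟨ sumWords-cong (suc K * n + β) (λ p → cong 𝟙 (accepts≡endsAt-walk K β n ρ 0 0 0 p)) ⟩
  pathsTo K (suc K * n + β) (β , n , ρ)
    ≡⟨ pathsTo-raney K _ β n ρ (cong (_+ β) (*-comm (suc K) n)) ⟩
  shift ρ (raney (suc K) m) n
    ≡⟨ sym (tPow-⊛ ρ (raney (suc K) m) n) ⟩
  (tPow ρ ⊛ raney (suc K) m) n
    ≡⟨ ⊛-cong {f = tPow ρ} (λ _ → refl) (λ j → sym (Ck^≡raney K m j)) n ⟩
  RHS (suc K) β n ρ
    ∎
  where
  open ≡-Reasoning
  m = β + ρ * K

proposition3p7 : (k β : ℕ) → 2 ≤ k → (n ρ : ℕ) → CGF k 0 β n ρ ≡ RHS k β n ρ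
proposition3p7 (suc K) β (s≤s _) n ρ = CGF≡RHS K β n ρ
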